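{- Let $k$ be a positive integer such that $k+1$ is not prime, and let $G$ be a connected loopless graph (parallel edges allowed) with $|V(G)|>2$ and $|E(G)|=k(|V(G)|-1)$. Then every $k$DSI matrix $M$ of $G$ satisfies $\mathrm{Perm}(M)\equiv 0\pmod{k+1}$.
   Context: Given a graph $G$ with an arbitrary orientation of its edges, its signed incidence matrix $M^*$ has rows indexed by vertices and columns by edges, with entry $1$ if the vertex is the tail of the edge, $-1$ if it is the head, and $0$ otherwise. For a chosen vertex $w$ (the special vertex), let $M_0$ be $M^*$ with the row of $w$ deleted. A $k$DSI matrix of $G$ is the block matrix obtained by stacking $k$ copies of $M_0$ vertically. The permanent of an $n\times n$ matrix $A$ is $\mathrm{Perm}(A)=\sum_{\sigma\in S_n}\prod_i a_{i,\sigma(i)}$. -}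

module Defs where

open import Data.Nat using (ℕ; zero; suc)
open import Data.Integer as ℤ using (ℤ; +_; -_)
open import Data.Fin as Fin using (Fin; punchIn; remQuot)
open import Data.Fin.Properties using (_≟_)
open import Data.Bool using (Bool; true; false; if_then_else_)
open import Data.Product using (_×_; _,_; proj₁; proj₂; ∃)
open import Data.Sum using (_⊎_)
open import Data.List using (List; []; _∷_; map; concatMap; foldr)
open import Data.List.Base using (allFin)
open import Data.Vec as Vec using (Vec; []; _∷_; lookup; toList)
open import Relation.Binary.PropositionalEquality using (_≡_; _≢_)
open import Relation.Binary.Construct.Closure.ReflexiveTransitive using (Star)
open import Relation.Nullary using (yes; no)
import Data.List.Relation.Unary.Unique.DecPropositional as UniqueDec

-- A (multi)graph on vertex set Fin n with edge set Fin m.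
-- Each edge e has a pair of endpoints (unordered in meaning; the
-- orientation is a separate datum). Parallel edges are allowed.
record Graph (n m : ℕ) : Set where
  field
    ends : Fin m → Fin n × Fin n

open Graph public

Loopless : ∀ {n m} → Graph n m → Set
Loopless G = ∀ e → proj₁ (ends G e) ≢ proj₂ (ends G e)

Adjacent : ∀ {n m} → Graph n m → Fin n → Fin n → Set
Adjacent G u v = ∃ λ e → (ends G e ≡ (u , v)) ⊎ (ends G e ≡ (v , u))

Connected : ∀ {n m} → Graph n m → Set
Connected G = ∀ u v → Star (Adjacent G) u v

Orientation : ℕ → Set
Orientation m = Fin m → Bool

tail head : ∀ {n m} → Graph n m → Orientation m → Fin m → Fin n
tail G o e = if o e then proj₁ (ends G e) else proj₂ (ends G e)
head G o e = if o e then proj₂ (ends G e) else proj₁ (ends G e)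

Matrix : ℕ → ℕ → Set
Matrix r c = Fin r → Fin c → ℤ

-- signed incidence matrix M*: 1 if v is the tail of e, -1 if head, else 0
-- (G loopless, so tail ≠ head)
incidence : ∀ {n m} → Graph n m → Orientation m → Matrix n m
incidence G o v e with v ≟ tail G o e
... | yes _ = + 1
... | no _ with v ≟ head G o e
... |   yes _ = - (+ 1)
... |   no _ = + 0

reducedIncidence : ∀ {p m} → Graph (suc p) m → Orientation m → Fin (suc p)
                 → Matrix p m
reducedIncidence G o w i e = incidence G o (punchIn w i) e

-- kDSI matrix: k copies of M0 stacked vertically; row index
-- i ∈ Fin (k * p) corresponds to (block, row) = remQuot p i
kDSI : ∀ (k : ℕ) {p m} → Graph (suc p) m → Orientation m → Fin (suc p)
     → Matrix (k Data.Nat.* p) m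
kDSI k {p} G o w i e = reducedIncidence G o w (proj₂ (remQuot {k} p i)) e

-- Permanent: sum over all permutations σ of Fin N of ∏ a(i, σ i).
-- Maps Fin N → Fin N are enumerated as vectors; permutations are exactly
-- the injective ones (entries pairwise distinct).

allVecs : ∀ (N : ℕ) (r : ℕ) → List (Vec (Fin N) r)
allVecs N zero = [] ∷ []
allVecs N (suc r) = concatMap (λ x → map (x ∷_) (allVecs N r)) (allFin N)

sumℤ : List ℤ → ℤ
sumℤ = foldr ℤ._+_ (+ 0)

prodOver : ∀ {N r} → (Fin r → Fin N → ℤ) → Vec (Fin N) r → ℤ
prodOver {r = zero} A [] = + 1
prodOver {r = suc r} A (x ∷ σ) = A Fin.zero x ℤ.* prodOver (λ i → A (Fin.suc i)) σ

permTerm : ∀ {N} → Matrix N N → Vec (Fin N) N → ℤ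
permTerm {N} A σ with UniqueDec.unique? (_≟_ {N}) (toList σ)
... | yes _ = prodOver A σ
... | no _ = + 0

Perm : ∀ {N} → Matrix N N → ℤ
Perm {N} A = sumℤ (map (permTerm A) (allVecs N N))

module Submission where

-- For (1) we use the partial permanent  pperm R U  of a list of rows R whose
-- entries must lie in distinct columns outside a set U of used columns.

open import Defs
open import Data.Nat using (ℕ; suc; _*_; _≤_)
open import Data.Nat.Primality using (Prime)
open import Data.Fin using (Fin)
open import Data.Integer using (+_)
open import Data.Integer.Divisibility using (_∣_)
open import Relation.Nullary using (¬_)

open import Data.Nat as ℕ using (zero; _!; s≤s; z≤n; _<_; _<?_)
import Data.Nat.Properties as ℕP
import Data.Nat.Divisibility as ℕD
open import Data.Nat.Primality using (¬prime⇒composite)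
open import Data.Nat.Divisibility.Core using (hasNonTrivialDivisor)
open import Data.Integer as ℤ using (ℤ; 0ℤ)
import Data.Integer.Properties as ℤP
open import Data.Integer.Divisibility.Signed as ℤD using (divides)
open import Data.Integer.Tactic.RingSolver using (solve-∀)
open import Algebra.Properties.Semiring.Sum ℤP.+-*-semiring
  using (sum; sum-syntax; sum-cong-≗; sum-remove; sum-replicate-zero; ∑-comm; ∑-distrib-+; *-distribˡ-sum)
open import Data.Fin using (zero; suc; toℕ; fromℕ<; punchIn; _↑ˡ_; _↑ʳ_; remQuot)
open import Data.Fin.Properties using (_≟_; toℕ-fromℕ<; toℕ<n; toℕ-injective; punchInᵢ≢i; splitAt-↑ˡ; splitAt-↑ʳ)
open import Data.Bool using (Bool; true; false; if_then_else_; _∨_; _∧_; not)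
open import Data.List using (List; []; _∷_; _++_; map; concatMap; concat; replicate; tabulate; allFin; [_])
import Data.List.Properties as LP
open import Data.List.Relation.Unary.All as All using (All; []; _∷_)
open import Data.List.Relation.Binary.Permutation.Propositional as ↭ using (_↭_)
open import Data.List.Relation.Binary.Permutation.Propositional.Properties using (shifts; ++⁺ˡ)
import Data.List.Relation.Unary.Unique.DecPropositional as UniqueDec
open import Data.List.Relation.Unary.AllPairs using ([]; _∷_)
open import Data.Vec using (Vec; []; _∷_; toList)
open import Data.Product using (_×_; _,_; proj₂)
open import Data.Empty using (⊥-elim)
open import Function using (_∘_; id)
open import Relation.Binary.PropositionalEquality
  using (_≡_; _≢_; _≗_; refl; sym; trans; cong; cong₂; subst; subst₂; module ≡-Reasoning)
open import Relation.Nullary using (does; yes; no)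
open import Relation.Nullary.Decidable using (dec-true; dec-false)

private
  variable
    N : ℕ

sumℤ-++ : (xs ys : List ℤ) → sumℤ (xs ++ ys) ≡ sumℤ xs ℤ.+ sumℤ ys
sumℤ-++ [] ys = sym (ℤP.+-identityˡ _)
sumℤ-++ (x ∷ xs) ys = trans (cong (λ t → x ℤ.+ t) (sumℤ-++ xs ys)) (sym (ℤP.+-assoc x _ _))

sumℤ-concatMap : {A B : Set} (f : B → ℤ) (g : A → List B) (xs : List A) →
  sumℤ (map f (concatMap g xs)) ≡ sumℤ (map (λ x → sumℤ (map f (g x))) xs)
sumℤ-concatMap f g [] = refl
sumℤ-concatMap f g (x ∷ xs) = begin
  sumℤ (map f (g x ++ concatMap g xs))               ≡⟨ cong sumℤ (LP.map-++ f (g x) _) ⟩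
  sumℤ (map f (g x) ++ map f (concatMap g xs))       ≡⟨ sumℤ-++ (map f (g x)) _ ⟩
  sumℤ (map f (g x)) ℤ.+ sumℤ (map f (concatMap g xs)) ≡⟨ cong (λ t → sumℤ (map f (g x)) ℤ.+ t) (sumℤ-concatMap f g xs) ⟩
  sumℤ (map f (g x)) ℤ.+ sumℤ (map (λ y → sumℤ (map f (g y))) xs) ∎
  where open ≡-Reasoning

sumℤ-scale : {A : Set} (c : ℤ) (f : A → ℤ) (xs : List A) →
  sumℤ (map (λ x → c ℤ.* f x) xs) ≡ c ℤ.* sumℤ (map f xs)
sumℤ-scale c f [] = sym (ℤP.*-zeroʳ c)
sumℤ-scale c f (x ∷ xs) = trans (cong (λ t → c ℤ.* f x ℤ.+ t) (sumℤ-scale c f xs)) (sym (ℤP.*-distribˡ-+ c (f x) _))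

sumℤ-allFin : (f : Fin N → ℤ) → sumℤ (map f (allFin N)) ≡ sum f
sumℤ-allFin {N} f = trans (cong sumℤ (LP.map-tabulate id f)) (sumℤ-tabulate N f)
  where
  sumℤ-tabulate : ∀ n (g : Fin n → ℤ) → sumℤ (tabulate g) ≡ sum g
  sumℤ-tabulate zero g = refl
  sumℤ-tabulate (suc n) g = cong (λ t → g zero ℤ.+ t) (sumℤ-tabulate n (g ∘ suc))

sum-zero : {f : Fin N → ℤ} → (∀ y → f y ≡ 0ℤ) → sum f ≡ 0ℤ
sum-zero {N} f≡0 = trans (sum-cong-≗ f≡0) (sum-replicate-zero N)

sum-point : (c : Fin N) (h : Fin N → ℤ) →
  sum (λ y → if does (y ≟ c) then h y else 0ℤ) ≡ h c
sum-point {suc n} c h = begin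
  sum δ                                ≡⟨ sum-remove {i = c} δ ⟩
  δ c ℤ.+ sum (λ j → δ (punchIn c j))   ≡⟨ cong₂ ℤ._+_ δc (sum-zero δ-off) ⟩
  h c ℤ.+ 0ℤ                           ≡⟨ ℤP.+-identityʳ (h c) ⟩
  h c                                  ∎
  where
  open ≡-Reasoning
  δ : Fin (suc n) → ℤ
  δ y = if does (y ≟ c) then h y else 0ℤ
  δc : δ c ≡ h c
  δc rewrite dec-true (c ≟ c) refl = refl
  δ-off : ∀ j → δ (punchIn c j) ≡ 0ℤ
  δ-off j rewrite dec-false (punchIn c j ≟ c) (punchInᵢ≢i c j) = refl

-- Partial permanents.  A mask marks the columns that are already used.

Row : ℕ → Set
Row N = Fin N → ℤ

Mask : ℕ → Set
Mask N = Fin N → Bool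

∅ : Mask N
∅ _ = false

use : Fin N → Mask N → Mask N
use x U z = does (z ≟ x) ∨ U z

free : Mask N → Row N → Row N
free U ρ y = if U y then 0ℤ else ρ y

pperm : List (Row N) → Mask N → ℤ
pperm [] U = + 1
pperm {N} (ρ ∷ R) U = ∑[ y < N ] (free U ρ y ℤ.* pperm R (use y U))

use-comm : (x y : Fin N) (U : Mask N) → use x (use y U) ≗ use y (use x U)
use-comm x y U z with does (z ≟ x) | does (z ≟ y)
... | true | true = refl
... | true | false = refl
... | false | _ = refl

use-fresh : {x y : Fin N} {U : Mask N} → x ≢ y → U y ≡ false → use x U y ≡ false
use-fresh {x = x} {y} x≢y Uy rewrite dec-false (y ≟ x) (x≢y ∘ sym) = Uy

use-used : (x : Fin N) (U : Mask N) {y : Fin N} → use x U y ≡ false → x ≢ y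
use-used x U {y} eq refl rewrite dec-true (x ≟ x) refl with eq
... | ()

pperm-cong : (R : List (Row N)) {U V : Mask N} → U ≗ V → pperm R U ≡ pperm R V
pperm-cong [] U≗V = refl
pperm-cong (ρ ∷ R) {U} {V} U≗V = sum-cong-≗ λ y →
  cong₂ ℤ._*_ (cong (λ b → if b then 0ℤ else ρ y) (U≗V y))
              (pperm-cong R (λ z → cong (does (z ≟ y) ∨_) (U≗V z)))

free-swap : (U : Mask N) (ρ σ : Row N) (y z : Fin N) →
  free U ρ y ℤ.* free (use y U) σ z ≡ free U σ z ℤ.* free (use z U) ρ y
free-swap U ρ σ y z with U y | U z | z ≟ y | y ≟ z
... | true  | true  | _      | _      = refl
... | true  | false | _      | yes _  = sym (ℤP.*-zeroʳ (σ z))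
... | true  | false | _      | no _   = sym (ℤP.*-zeroʳ (σ z))
... | false | true  | yes _  | _      = ℤP.*-zeroʳ (ρ y)
... | false | true  | no _   | _      = ℤP.*-zeroʳ (ρ y)
... | false | false | yes _  | yes _  = trans (ℤP.*-zeroʳ (ρ y)) (sym (ℤP.*-zeroʳ (σ z)))
... | false | false | yes z≡y | no y≢z = ⊥-elim (y≢z (sym z≡y))
... | false | false | no z≢y | yes y≡z = ⊥-elim (z≢y (sym y≡z))
... | false | false | no _   | no _   = ℤP.*-comm (ρ y) (σ z)

pperm-swap : (ρ σ : Row N) (R : List (Row N)) (U : Mask N) →
  pperm (ρ ∷ σ ∷ R) U ≡ pperm (σ ∷ ρ ∷ R) U
pperm-swap {N} ρ σ R U = begin
  ∑[ y < N ] (free U ρ y ℤ.* ∑[ z < N ] (free (use y U) σ z ℤ.* pperm R (use z (use y U))))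
    ≡⟨ sum-cong-≗ (λ y → *-distribˡ-sum (free U ρ y) (λ z → free (use y U) σ z ℤ.* pperm R (use z (use y U)))) ⟩
  ∑[ y < N ] ∑[ z < N ] (free U ρ y ℤ.* (free (use y U) σ z ℤ.* pperm R (use z (use y U))))
    ≡⟨ sum-cong-≗ (λ y → sum-cong-≗ (λ z → term-swap y z)) ⟩
  ∑[ y < N ] ∑[ z < N ] (free U σ z ℤ.* (free (use z U) ρ y ℤ.* pperm R (use y (use z U))))
    ≡⟨ ∑-comm (λ y z → free U σ z ℤ.* (free (use z U) ρ y ℤ.* pperm R (use y (use z U)))) ⟩
  ∑[ z < N ] ∑[ y < N ] (free U σ z ℤ.* (free (use z U) ρ y ℤ.* pperm R (use y (use z U))))
    ≡⟨ sum-cong-≗ (λ z → *-distribˡ-sum (free U σ z) (λ y → free (use z U) ρ y ℤ.* pperm R (use y (use z U)))) ⟨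
  ∑[ z < N ] (free U σ z ℤ.* ∑[ y < N ] (free (use z U) ρ y ℤ.* pperm R (use y (use z U))))
    ∎
  where
  open ≡-Reasoning
  term-swap : ∀ y z →
    free U ρ y ℤ.* (free (use y U) σ z ℤ.* pperm R (use z (use y U))) ≡
    free U σ z ℤ.* (free (use z U) ρ y ℤ.* pperm R (use y (use z U)))
  term-swap y z = begin
    free U ρ y ℤ.* (free (use y U) σ z ℤ.* pperm R (use z (use y U)))
      ≡⟨ ℤP.*-assoc (free U ρ y) _ _ ⟨
    free U ρ y ℤ.* free (use y U) σ z ℤ.* pperm R (use z (use y U))
      ≡⟨ cong₂ ℤ._*_ (free-swap U ρ σ y z) (pperm-cong R (use-comm z y U)) ⟩
    free U σ z ℤ.* free (use z U) ρ y ℤ.* pperm R (use y (use z U))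
      ≡⟨ ℤP.*-assoc (free U σ z) _ _ ⟩
    free U σ z ℤ.* (free (use z U) ρ y ℤ.* pperm R (use y (use z U)))
      ∎

pperm-cons : (ρ : Row N) (R R′ : List (Row N)) → (∀ V → pperm R V ≡ pperm R′ V) →
  (U : Mask N) → pperm (ρ ∷ R) U ≡ pperm (ρ ∷ R′) U
pperm-cons ρ R R′ R≡R′ U = sum-cong-≗ λ y → cong (λ t → free U ρ y ℤ.* t) (R≡R′ (use y U))

pperm-↭ : {R R′ : List (Row N)} → R ↭ R′ → (U : Mask N) → pperm R U ≡ pperm R′ U
pperm-↭ ↭.refl U = refl
pperm-↭ (↭.prep {xs} {ys} ρ p) = pperm-cons ρ xs ys (pperm-↭ p)
pperm-↭ (↭.swap {xs} {ys} ρ σ p) U =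
  trans (pperm-swap ρ σ xs U) (pperm-cons σ (ρ ∷ xs) (ρ ∷ ys) (pperm-cons ρ xs ys (pperm-↭ p)) U)
pperm-↭ (↭.trans p q) U = trans (pperm-↭ p U) (pperm-↭ q U)

prodFree : ∀ {r} → (Fin r → Row N) → Mask N → Vec (Fin N) r → ℤ
prodFree B U [] = + 1
prodFree B U (x ∷ σ) = free U (B zero) x ℤ.* prodFree (B ∘ suc) (use x U) σ

sum-prodFree : ∀ r (B : Fin r → Row N) (U : Mask N) →
  sumℤ (map (prodFree B U) (allVecs N r)) ≡ pperm (tabulate B) U
sum-prodFree zero B U = ℤP.+-identityʳ (+ 1)
sum-prodFree {N} (suc r) B U = begin
  sumℤ (map (prodFree B U) (concatMap (λ x → map (x ∷_) (allVecs N r)) (allFin N)))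
    ≡⟨ sumℤ-concatMap (prodFree B U) (λ x → map (x ∷_) (allVecs N r)) (allFin N) ⟩
  sumℤ (map (λ x → sumℤ (map (prodFree B U) (map (x ∷_) (allVecs N r)))) (allFin N))
    ≡⟨ sumℤ-allFin (λ x → sumℤ (map (prodFree B U) (map (x ∷_) (allVecs N r)))) ⟩
  ∑[ x < N ] sumℤ (map (prodFree B U) (map (x ∷_) (allVecs N r)))
    ≡⟨ sum-cong-≗ first-column ⟩
  ∑[ x < N ] (free U (B zero) x ℤ.* pperm (tabulate (B ∘ suc)) (use x U))
    ∎
  where
  open ≡-Reasoning
  first-column : ∀ x → sumℤ (map (prodFree B U) (map (x ∷_) (allVecs N r))) ≡
                       free U (B zero) x ℤ.* pperm (tabulate (B ∘ suc)) (use x U)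
  first-column x = begin
    sumℤ (map (prodFree B U) (map (x ∷_) (allVecs N r)))
      ≡⟨ cong sumℤ (LP.map-∘ (allVecs N r)) ⟨
    sumℤ (map (λ σ → free U (B zero) x ℤ.* prodFree (B ∘ suc) (use x U) σ) (allVecs N r))
      ≡⟨ sumℤ-scale (free U (B zero) x) _ (allVecs N r) ⟩
    free U (B zero) x ℤ.* sumℤ (map (prodFree (B ∘ suc) (use x U)) (allVecs N r))
      ≡⟨ cong (λ t → free U (B zero) x ℤ.* t) (sum-prodFree r (B ∘ suc) (use x U)) ⟩
    free U (B zero) x ℤ.* pperm (tabulate (B ∘ suc)) (use x U)
      ∎

good : ∀ {r} → Mask N → Vec (Fin N) r → Bool
good U [] = true
good U (x ∷ σ) = not (U x) ∧ good (use x U) σ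

prodFree-good : ∀ {r} (B : Fin r → Row N) (U : Mask N) (σ : Vec (Fin N) r) →
  prodFree B U σ ≡ (if good U σ then prodOver B σ else 0ℤ)
prodFree-good B U [] = refl
prodFree-good B U (x ∷ σ) with U x
... | true = refl
... | false rewrite prodFree-good (B ∘ suc) (use x U) σ with good (use x U) σ
...   | true = refl
...   | false = ℤP.*-zeroʳ (B zero x)

good⇒fresh : ∀ {r} (U : Mask N) (σ : Vec (Fin N) r) → good U σ ≡ true →
  All (λ y → U y ≡ false) (toList σ)
good⇒fresh U [] _ = []
good⇒fresh U (x ∷ σ) g with U x in Ux
... | false = Ux ∷ All.map fresh-before-use (good⇒fresh (use x U) σ g)
  where
  fresh-before-use : ∀ {y} → use x U y ≡ false → U y ≡ false
  fresh-before-use {y} eq with does (y ≟ x)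
  ... | false = eq

good⇒unique : ∀ {r} (U : Mask N) (σ : Vec (Fin N) r) → good U σ ≡ true →
  UniqueDec.Unique _≟_ (toList σ)
good⇒unique U [] _ = []
good⇒unique U (x ∷ σ) g with U x
... | false = All.map (use-used x U) (good⇒fresh (use x U) σ g) ∷ good⇒unique (use x U) σ g

unique⇒good : ∀ {r} (U : Mask N) (σ : Vec (Fin N) r) → UniqueDec.Unique _≟_ (toList σ) →
  All (λ y → U y ≡ false) (toList σ) → good U σ ≡ true
unique⇒good U [] _ _ = refl
unique⇒good U (x ∷ σ) (x∉σ ∷ uσ) (Ux ∷ fσ) rewrite Ux =
  unique⇒good (use x U) σ uσ (All.zipWith (λ (x≢y , Uy) → use-fresh {U = U} x≢y Uy) (x∉σ , fσ))

permTerm-prodFree : (A : Matrix N N) (σ : Vec (Fin N) N) → permTerm A σ ≡ prodFree A ∅ σ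
permTerm-prodFree A σ with UniqueDec.unique? _≟_ (toList σ)
... | yes u rewrite prodFree-good A ∅ σ
                  | unique⇒good ∅ σ u (All.tabulate (λ _ → refl)) = refl
... | no ¬u rewrite prodFree-good A ∅ σ with good ∅ σ in g
...   | true = ⊥-elim (¬u (good⇒unique ∅ σ g))
...   | false = refl

Perm-pperm : (A : Matrix N N) → Perm A ≡ pperm (tabulate A) ∅
Perm-pperm {N} A =
  trans (cong sumℤ (LP.map-cong (permTerm-prodFree A) (allVecs N N))) (sum-prodFree N A ∅)

-- Laplace expansion along a column.  colTerm X c R U is the sum, over the
-- rows ρ of R, of ρ c times the partial permanent of X followed by R
-- without that occurrence of ρ: the contributions in which column c is
-- taken by a row of R.

colTerm : List (Row N) → Fin N → List (Row N) → Mask N → ℤ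
colTerm X c [] U = 0ℤ
colTerm X c (ρ ∷ R) U = ρ c ℤ.* pperm (X ++ R) U ℤ.+ colTerm (X ++ [ ρ ]) c R U

colTerm-cong : (X : List (Row N)) (c : Fin N) (R : List (Row N)) {U V : Mask N} →
  U ≗ V → colTerm X c R U ≡ colTerm X c R V
colTerm-cong X c [] U≗V = refl
colTerm-cong X c (ρ ∷ R) U≗V =
  cong₂ (λ a b → ρ c ℤ.* a ℤ.+ b) (pperm-cong (X ++ R) U≗V) (colTerm-cong (X ++ [ ρ ]) c R U≗V)

colTerm-prefix : (ρ : Row N) (X : List (Row N)) (c : Fin N) (R : List (Row N)) (W : Mask N) →
  colTerm (ρ ∷ X) c R W ≡ ∑[ y < N ] (free W ρ y ℤ.* colTerm X c R (use y W))
colTerm-prefix {N} ρ X c [] W = sym (sum-zero (λ y → ℤP.*-zeroʳ (free W ρ y)))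
colTerm-prefix {N} ρ X c (σ ∷ R) W = begin
  σ c ℤ.* pperm (ρ ∷ X ++ R) W ℤ.+ colTerm (ρ ∷ X ++ [ σ ]) c R W
    ≡⟨ cong (λ t → σ c ℤ.* pperm (ρ ∷ X ++ R) W ℤ.+ t) (colTerm-prefix ρ (X ++ [ σ ]) c R W) ⟩
  σ c ℤ.* ∑[ y < N ] (f y ℤ.* P y) ℤ.+ ∑[ y < N ] (f y ℤ.* C y)
    ≡⟨ cong (λ t → t ℤ.+ ∑[ y < N ] (f y ℤ.* C y)) (*-distribˡ-sum (σ c) (λ y → f y ℤ.* P y)) ⟩
  ∑[ y < N ] (σ c ℤ.* (f y ℤ.* P y)) ℤ.+ ∑[ y < N ] (f y ℤ.* C y)
    ≡⟨ ∑-distrib-+ (λ y → σ c ℤ.* (f y ℤ.* P y)) (λ y → f y ℤ.* C y) ⟨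
  ∑[ y < N ] (σ c ℤ.* (f y ℤ.* P y) ℤ.+ f y ℤ.* C y)
    ≡⟨ sum-cong-≗ (λ y → regroup (σ c) (f y) (P y) (C y)) ⟩
  ∑[ y < N ] (f y ℤ.* (σ c ℤ.* P y ℤ.+ C y))
    ∎
  where
  open ≡-Reasoning
  f : Fin N → ℤ
  f y = free W ρ y
  P C : Fin N → ℤ
  P y = pperm (X ++ R) (use y W)
  C y = colTerm (X ++ [ σ ]) c R (use y W)
  regroup : ∀ a b t e → a ℤ.* (b ℤ.* t) ℤ.+ b ℤ.* e ≡ b ℤ.* (a ℤ.* t ℤ.+ e)
  regroup = solve-∀

split-column : (U : Mask N) (c : Fin N) → U c ≡ false → (ρ : Row N) (g : Fin N → ℤ) →
  ∑[ y < N ] (free U ρ y ℤ.* g y) ≡ ρ c ℤ.* g c ℤ.+ ∑[ y < N ] (free (use c U) ρ y ℤ.* g y)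
split-column {N} U c Uc ρ g = begin
  ∑[ y < N ] (free U ρ y ℤ.* g y)
    ≡⟨ sum-cong-≗ split-entry ⟩
  ∑[ y < N ] ((if does (y ≟ c) then ρ y ℤ.* g y else 0ℤ) ℤ.+ free (use c U) ρ y ℤ.* g y)
    ≡⟨ ∑-distrib-+ _ (λ y → free (use c U) ρ y ℤ.* g y) ⟩
  ∑[ y < N ] (if does (y ≟ c) then ρ y ℤ.* g y else 0ℤ) ℤ.+ ∑[ y < N ] (free (use c U) ρ y ℤ.* g y)
    ≡⟨ cong (λ t → t ℤ.+ ∑[ y < N ] (free (use c U) ρ y ℤ.* g y)) (sum-point c (λ y → ρ y ℤ.* g y)) ⟩
  ρ c ℤ.* g c ℤ.+ ∑[ y < N ] (free (use c U) ρ y ℤ.* g y)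
    ∎
  where
  open ≡-Reasoning
  split-entry : ∀ y → free U ρ y ℤ.* g y ≡
    (if does (y ≟ c) then ρ y ℤ.* g y else 0ℤ) ℤ.+ free (use c U) ρ y ℤ.* g y
  split-entry y with y ≟ c
  ... | yes refl rewrite Uc = sym (ℤP.+-identityʳ (ρ y ℤ.* g y))
  ... | no _ = sym (ℤP.+-identityˡ (free U ρ y ℤ.* g y))

laplace : (R : List (Row N)) (U : Mask N) (c : Fin N) → U c ≡ false →
  pperm R U ≡ pperm R (use c U) ℤ.+ colTerm [] c R (use c U)
laplace [] U c Uc = sym (ℤP.+-identityʳ (+ 1))
laplace {N} (ρ ∷ R) U c Uc = begin
  ∑[ y < N ] (free U ρ y ℤ.* pperm R (use y U))
    ≡⟨ split-column U c Uc ρ (λ y → pperm R (use y U)) ⟩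
  ρ c ℤ.* pperm R W ℤ.+ ∑[ y < N ] (free W ρ y ℤ.* pperm R (use y U))
    ≡⟨ cong (λ t → ρ c ℤ.* pperm R W ℤ.+ t) (sum-cong-≗ expand-entry) ⟩
  ρ c ℤ.* pperm R W ℤ.+ ∑[ y < N ] (free W ρ y ℤ.* pperm R (use y W) ℤ.+ free W ρ y ℤ.* colTerm [] c R (use y W))
    ≡⟨ cong (λ t → ρ c ℤ.* pperm R W ℤ.+ t)
         (∑-distrib-+ (λ y → free W ρ y ℤ.* pperm R (use y W)) (λ y → free W ρ y ℤ.* colTerm [] c R (use y W))) ⟩
  ρ c ℤ.* pperm R W ℤ.+ (pperm (ρ ∷ R) W ℤ.+ ∑[ y < N ] (free W ρ y ℤ.* colTerm [] c R (use y W)))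
    ≡⟨ cong (λ t → ρ c ℤ.* pperm R W ℤ.+ (pperm (ρ ∷ R) W ℤ.+ t)) (colTerm-prefix ρ [] c R W) ⟨
  ρ c ℤ.* pperm R W ℤ.+ (pperm (ρ ∷ R) W ℤ.+ colTerm [ ρ ] c R W)
    ≡⟨ ℤP.+-assoc (ρ c ℤ.* pperm R W) _ _ ⟨
  ρ c ℤ.* pperm R W ℤ.+ pperm (ρ ∷ R) W ℤ.+ colTerm [ ρ ] c R W
    ≡⟨ cong (ℤ._+ colTerm [ ρ ] c R W) (ℤP.+-comm (ρ c ℤ.* pperm R W) _) ⟩
  pperm (ρ ∷ R) W ℤ.+ ρ c ℤ.* pperm R W ℤ.+ colTerm [ ρ ] c R W
    ≡⟨ ℤP.+-assoc (pperm (ρ ∷ R) W) _ _ ⟩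
  pperm (ρ ∷ R) W ℤ.+ colTerm [] c (ρ ∷ R) W
    ∎
  where
  open ≡-Reasoning
  W : Mask N
  W = use c U
  -- a row placed in a column y ≠ c leaves c free, so expand the rest along c
  expand-entry : ∀ y → free W ρ y ℤ.* pperm R (use y U) ≡
    free W ρ y ℤ.* pperm R (use y W) ℤ.+ free W ρ y ℤ.* colTerm [] c R (use y W)
  expand-entry y with y ≟ c | U y in Uy
  ... | yes _ | _ = refl
  ... | no _ | true = refl
  ... | no y≢c | false = begin
    ρ y ℤ.* pperm R (use y U)
      ≡⟨ cong (ρ y ℤ.*_) (laplace R (use y U) c (use-fresh {U = U} y≢c Uc)) ⟩
    ρ y ℤ.* (pperm R (use c (use y U)) ℤ.+ colTerm [] c R (use c (use y U)))
      ≡⟨ cong (ρ y ℤ.*_) (cong₂ ℤ._+_ (pperm-cong R (use-comm c y U)) (colTerm-cong [] c R (use-comm c y U))) ⟩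
    ρ y ℤ.* (pperm R (use y W) ℤ.+ colTerm [] c R (use y W))
      ≡⟨ ℤP.*-distribˡ-+ (ρ y) _ _ ⟩
    ρ y ℤ.* pperm R (use y W) ℤ.+ ρ y ℤ.* colTerm [] c R (use y W)
      ∎

Block : ℕ → Set
Block N = Row N × ℕ

expand : List (Block N) → List (Row N)
expand [] = []
expand ((ρ , m) ∷ bs) = replicate m ρ ++ expand bs

weight : List (Block N) → ℕ
weight [] = 1
weight ((ρ , m) ∷ bs) = m ! * weight bs

expand-++ : (as bs : List (Block N)) → expand (as ++ bs) ≡ expand as ++ expand bs
expand-++ [] bs = refl
expand-++ ((ρ , m) ∷ as) bs =
  trans (cong (replicate m ρ ++_) (expand-++ as bs)) (sym (LP.++-assoc (replicate m ρ) (expand as) (expand bs)))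

expand-snoc : (pre : List (Block N)) (ρ : Row N) (m : ℕ) →
  expand (pre ++ [ (ρ , m) ]) ≡ expand pre ++ replicate m ρ
expand-snoc pre ρ m = trans (expand-++ pre _) (cong (expand pre ++_) (LP.++-identityʳ (replicate m ρ)))

weight-snoc : (pre : List (Block N)) (b : Block N) (bs : List (Block N)) →
  weight ((pre ++ [ b ]) ++ bs) ≡ weight (pre ++ b ∷ bs)
weight-snoc pre b bs = cong weight (LP.++-assoc pre [ b ] bs)

weight-bump : (pre : List (Block N)) (ρ : Row N) (m : ℕ) (bs : List (Block N)) →
  weight (pre ++ (ρ , suc m) ∷ bs) ≡ suc m * weight (pre ++ (ρ , m) ∷ bs)
weight-bump [] ρ m bs = ℕP.*-assoc (suc m) (m !) (weight bs)
weight-bump ((σ , n) ∷ pre) ρ m bs = begin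
  n ! * weight (pre ++ (ρ , suc m) ∷ bs)         ≡⟨ cong (n ! *_) (weight-bump pre ρ m bs) ⟩
  n ! * (suc m * weight (pre ++ (ρ , m) ∷ bs))   ≡⟨ ℕP.*-assoc (n !) (suc m) _ ⟨
  n ! * suc m * weight (pre ++ (ρ , m) ∷ bs)     ≡⟨ cong (_* weight (pre ++ (ρ , m) ∷ bs)) (ℕP.*-comm (n !) (suc m)) ⟩
  suc m * n ! * weight (pre ++ (ρ , m) ∷ bs)     ≡⟨ ℕP.*-assoc (suc m) (n !) _ ⟩
  suc m * (n ! * weight (pre ++ (ρ , m) ∷ bs))   ∎
  where open ≡-Reasoning

weight-empty : (bs : List (Block N)) → expand bs ≡ [] → weight bs ≡ 1
weight-empty [] _ = refl
weight-empty ((ρ , zero) ∷ bs) eq = trans (ℕP.+-identityʳ (weight bs)) (weight-empty bs eq)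

colTerm-block : (Y : List (Row N)) (c : Fin N) (ρ : Row N) (n : ℕ) (B : List (Row N)) (U : Mask N) →
  colTerm Y c (replicate (suc n) ρ ++ B) U ≡
  + suc n ℤ.* (ρ c ℤ.* pperm (Y ++ replicate n ρ ++ B) U) ℤ.+ colTerm (Y ++ replicate (suc n) ρ) c B U
colTerm-block Y c ρ zero B U =
  cong (ℤ._+ colTerm (Y ++ [ ρ ]) c B U) (sym (ℤP.*-identityˡ (ρ c ℤ.* pperm (Y ++ B) U)))
colTerm-block Y c ρ (suc n) B U = begin
  a ℤ.+ colTerm (Y ++ [ ρ ]) c (replicate (suc n) ρ ++ B) U
    ≡⟨ cong (λ t → a ℤ.+ t) (colTerm-block (Y ++ [ ρ ]) c ρ n B U) ⟩
  a ℤ.+ (+ suc n ℤ.* (ρ c ℤ.* pperm ((Y ++ [ ρ ]) ++ replicate n ρ ++ B) U)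
         ℤ.+ colTerm ((Y ++ [ ρ ]) ++ replicate (suc n) ρ) c B U)
    ≡⟨ cong₂ (λ X Z → a ℤ.+ (+ suc n ℤ.* (ρ c ℤ.* pperm X U) ℤ.+ colTerm Z c B U))
             (LP.++-assoc Y [ ρ ] _) (LP.++-assoc Y [ ρ ] _) ⟩
  a ℤ.+ (+ suc n ℤ.* a ℤ.+ colTerm (Y ++ replicate (suc (suc n)) ρ) c B U)
    ≡⟨ collect a (+ suc n) _ ⟩
  + suc (suc n) ℤ.* a ℤ.+ colTerm (Y ++ replicate (suc (suc n)) ρ) c B U
    ∎
  where
  open ≡-Reasoning
  a : ℤ
  a = ρ c ℤ.* pperm (Y ++ replicate (suc n) ρ ++ B) U
  collect : ∀ a n e → a ℤ.+ (n ℤ.* a ℤ.+ e) ≡ (+ 1 ℤ.+ n) ℤ.* a ℤ.+ e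
  collect = solve-∀

colTerm-divisible : (V : Mask N) (c : Fin N) →
  (∀ bs → + weight bs ℤD.∣ pperm (expand bs) V) →
  ∀ pre bs → + weight (pre ++ bs) ℤD.∣ colTerm (expand pre) c (expand bs) V
colTerm-divisible V c H pre [] = divides 0ℤ refl
colTerm-divisible V c H pre ((ρ , zero) ∷ bs) =
  subst₂ ℤD._∣_ (cong +_ (weight-snoc pre (ρ , zero) bs))
    (cong (λ X → colTerm X c (expand bs) V) (trans (expand-snoc pre ρ zero) (LP.++-identityʳ (expand pre))))
    (colTerm-divisible V c H (pre ++ [ (ρ , zero) ]) bs)
colTerm-divisible V c H pre ((ρ , suc m) ∷ bs) =
  subst (+ weight (pre ++ (ρ , suc m) ∷ bs) ℤD.∣_) (sym (colTerm-block (expand pre) c ρ m (expand bs) V))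
    (ℤD.∣m∣n⇒∣m+n copies-of-ρ later-blocks)
  where
  copies-of-ρ : + weight (pre ++ (ρ , suc m) ∷ bs) ℤD.∣
                + suc m ℤ.* (ρ c ℤ.* pperm (expand pre ++ replicate m ρ ++ expand bs) V)
  copies-of-ρ =
    subst₂ ℤD._∣_ (trans (sym (ℤP.pos-* (suc m) _)) (cong +_ (sym (weight-bump pre ρ m bs))))
      (cong (λ X → + suc m ℤ.* (ρ c ℤ.* pperm X V)) (expand-++ pre ((ρ , m) ∷ bs)))
      (ℤD.*-monoʳ-∣ (+ suc m) (ℤD.∣n⇒∣m*n (ρ c) (H (pre ++ (ρ , m) ∷ bs))))
  later-blocks : + weight (pre ++ (ρ , suc m) ∷ bs) ℤD.∣
                 colTerm (expand pre ++ replicate (suc m) ρ) c (expand bs) V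
  later-blocks =
    subst₂ ℤD._∣_ (cong +_ (weight-snoc pre (ρ , suc m) bs))
      (cong (λ X → colTerm X c (expand bs) V) (expand-snoc pre ρ (suc m)))
      (colTerm-divisible V c H (pre ++ [ (ρ , suc m) ]) bs)

firstCols : ℕ → Mask N
firstCols j y = does (toℕ y <? j)

firstCols-zero : firstCols {N} 0 ≗ ∅
firstCols-zero y = dec-false (toℕ y <? 0) λ ()

firstCols-full : ∀ {j} → j ≡ N → (y : Fin N) → firstCols j y ≡ true
firstCols-full refl y = dec-true (toℕ y <? _) (toℕ<n y)

firstCols-next : ∀ {j} (j<N : j < N) → firstCols j (fromℕ< j<N) ≡ false
firstCols-next {j = j} j<N rewrite toℕ-fromℕ< j<N = dec-false (j <? j) (ℕP.n≮n j)

firstCols-use : ∀ {j} (j<N : j < N) → use (fromℕ< j<N) (firstCols j) ≗ firstCols (suc j)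
firstCols-use {j = j} j<N y with y ≟ fromℕ< j<N
... | yes refl rewrite toℕ-fromℕ< j<N = sym (dec-true (j <? suc j) (ℕP.n<1+n j))
... | no y≢c with toℕ y <? j
...   | yes y<j = trans (dec-true (toℕ y <? j) y<j) (sym (dec-true (toℕ y <? suc j) (ℕP.m<n⇒m<1+n y<j)))
...   | no y≮j = trans (dec-false (toℕ y <? j) y≮j) (sym (dec-false (toℕ y <? suc j) λ y<1+j →
          y≮j (ℕP.≤∧≢⇒< (ℕ.s≤s⁻¹ y<1+j) λ y≡j → y≢c (toℕ-injective (trans y≡j (sym (toℕ-fromℕ< j<N)))))))

-- Block divisibility, by induction on the number t of free columns: when no
-- column is free the partial permanent is 1 (no rows) or 0; otherwise expand
-- along the first free column.
pperm-divisible : ∀ t j → j ℕ.+ t ≡ N → (bs : List (Block N)) →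
  + weight bs ℤD.∣ pperm (expand bs) (firstCols j)
pperm-divisible zero j j+0≡N bs with expand bs in eq
... | [] = subst (λ w → + w ℤD.∣ + 1) (sym (weight-empty bs eq)) ℤD.∣-refl
... | ρ ∷ R = subst (+ weight bs ℤD.∣_) (sym (sum-zero no-free-column)) (divides 0ℤ refl)
  where
  no-free-column : ∀ y → free (firstCols j) ρ y ℤ.* pperm R (use y (firstCols j)) ≡ 0ℤ
  no-free-column y rewrite firstCols-full (trans (sym (ℕP.+-identityʳ j)) j+0≡N) y = refl
pperm-divisible {N} (suc t) j j+t≡N bs =
  subst (+ weight bs ℤD.∣_) (sym expansion)
    (ℤD.∣m∣n⇒∣m+n (IH bs) (colTerm-divisible (firstCols (suc j)) c IH [] bs))
  where
  j<N : j < N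
  j<N = subst (j <_) j+t≡N (ℕP.m<m+n j (s≤s z≤n))
  c : Fin N
  c = fromℕ< j<N
  IH : ∀ bs′ → + weight bs′ ℤD.∣ pperm (expand bs′) (firstCols (suc j))
  IH = pperm-divisible t (suc j) (trans (sym (ℕP.+-suc j t)) j+t≡N)
  expansion : pperm (expand bs) (firstCols j) ≡
              pperm (expand bs) (firstCols (suc j)) ℤ.+ colTerm [] c (expand bs) (firstCols (suc j))
  expansion = trans (laplace (expand bs) (firstCols j) c (firstCols-next j<N))
    (cong₂ ℤ._+_ (pperm-cong (expand bs) (firstCols-use j<N)) (colTerm-cong [] c (expand bs) (firstCols-use j<N)))

block-divisible : (bs : List (Block N)) → + weight bs ℤD.∣ pperm (expand bs) ∅
block-divisible {N} bs =
  subst (+ weight bs ℤD.∣_) (pperm-cong (expand bs) firstCols-zero) (pperm-divisible N 0 refl bs)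

-- (3): a composite number k + 1 divides k! · k!, since it is a product a · b
-- of two factors 1 ≤ a, b ≤ k, each of which divides k!.
composite∣factorial² : ∀ k → ¬ Prime (suc k) → suc k ℕD.∣ k ! * k !
composite∣factorial² zero _ = ℕD.1∣ 1
composite∣factorial² (suc k) ¬prime with ¬prime⇒composite ¬prime
... | hasNonTrivialDivisor {a} a<k+2 (ℕD.divides b k+2≡b*a) =
  subst (ℕD._∣ suc k ! * suc k !) (sym k+2≡b*a)
    (ℕD.*-pres-∣ (∣factorial (positive b k+2≡b*a) b<k+2) (∣factorial (ℕ.nonTrivial⇒nonZero a) a<k+2))
  where
  ∣factorial : ∀ {d n} → ℕ.NonZero d → d < suc n → d ℕD.∣ n !
  ∣factorial {suc d} _ (s≤s d≤n) = ℕD.∣-trans (ℕD.m∣m*n (d !)) (ℕD.m≤n⇒m!∣n! d≤n)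
  positive : ∀ x {y} → suc y ≡ x * a → ℕ.NonZero x
  positive zero ()
  positive (suc x) _ = _
  b<k+2 : b < suc (suc k)
  b<k+2 = ℕD.quotient-< (ℕD.divides b k+2≡b*a)

tabulate-++ : {A : Set} (m n : ℕ) (g : Fin (m ℕ.+ n) → A) →
  tabulate g ≡ tabulate (g ∘ (_↑ˡ n)) ++ tabulate (g ∘ (m ↑ʳ_))
tabulate-++ zero n g = refl
tabulate-++ (suc m) n g = cong (g zero ∷_) (tabulate-++ m n (g ∘ suc))

tabulate-remQuot : {A : Set} (k p : ℕ) (f : Fin p → A) →
  tabulate (λ i → f (proj₂ (remQuot {k} p i))) ≡ concat (replicate k (tabulate f))
tabulate-remQuot zero p f = refl
tabulate-remQuot (suc k) p f =
  trans (tabulate-++ p (k * p) _)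
    (cong₂ _++_ (LP.tabulate-cong first-copy) (trans (LP.tabulate-cong later-copies) (tabulate-remQuot k p f)))
  where
  first-copy : ∀ i → f (proj₂ (remQuot {suc k} p (i ↑ˡ (k * p)))) ≡ f i
  first-copy i rewrite splitAt-↑ˡ p i (k * p) = refl
  later-copies : ∀ i → f (proj₂ (remQuot {suc k} p (p ↑ʳ i))) ≡ f (proj₂ (remQuot {k} p i))
  later-copies i rewrite splitAt-↑ʳ p (k * p) i = refl

copies-↭-blocks : (k : ℕ) (L : List (Row N)) → concat (replicate k L) ↭ expand (map (_, k) L)
copies-↭-blocks zero L = ↭.↭-reflexive (sym (no-copies L))
  where
  no-copies : (L : List (Row N)) → expand (map (_, 0) L) ≡ []
  no-copies [] = refl
  no-copies (_ ∷ L) = no-copies L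
copies-↭-blocks (suc k) L = ↭.trans (++⁺ˡ L (copies-↭-blocks k L)) (one-more-copy L)
  where
  one-more-copy : (L : List (Row N)) → L ++ expand (map (_, k) L) ↭ expand (map (_, suc k) L)
  one-more-copy [] = ↭.refl
  one-more-copy (ρ ∷ L) =
    ↭.prep ρ (↭.trans (shifts L (replicate k ρ)) (++⁺ˡ (replicate k ρ) (one-more-copy L)))

proposition3p3 : (k : ℕ) → 1 ≤ k → ¬ Prime (suc k)
    → (p : ℕ) → 2 ≤ p
    → (G : Graph (suc p) (k * p)) → Loopless G → Connected G
    → (o : Orientation (k * p)) → (w : Fin (suc p))
    → (+ (suc k)) ∣ Perm (kDSI k G o w)
proposition3p3 k _ ¬prime p (s≤s (s≤s _)) G _ _ o w =
  ℕD.∣-trans (composite∣factorial² k ¬prime) (ℕD.∣-trans k!²∣weight weight∣Perm)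
  where
  open ≡-Reasoning
  M₀ : Matrix p (k * p)
  M₀ = reducedIncidence G o w
  blocks : List (Block (k * p))
  blocks = map (_, k) (tabulate M₀)
  Perm-as-blocks : Perm (kDSI k G o w) ≡ pperm (expand blocks) ∅
  Perm-as-blocks = begin
    Perm (kDSI k G o w)                          ≡⟨ Perm-pperm (kDSI k G o w) ⟩
    pperm (tabulate (kDSI k G o w)) ∅            ≡⟨ cong (λ R → pperm R ∅) (tabulate-remQuot k p M₀) ⟩
    pperm (concat (replicate k (tabulate M₀))) ∅ ≡⟨ pperm-↭ (copies-↭-blocks k (tabulate M₀)) ∅ ⟩
    pperm (expand blocks) ∅                      ∎
  weight∣Perm : weight blocks ℕD.∣ ℤ.∣ Perm (kDSI k G o w) ∣
  weight∣Perm = ℤD.∣⇒∣ᵤ (subst (+ weight blocks ℤD.∣_) (sym Perm-as-blocks) (block-divisible blocks))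
  -- the first two of the p ≥ 2 blocks each contribute a factor k!
  k!²∣weight : k ! * k ! ℕD.∣ weight blocks
  k!²∣weight = ℕD.*-monoʳ-∣ (k !) (ℕD.m∣m*n _)
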